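{- For every graph $G$, $\psi(G)\leq\gamma_M(G)+\gamma(G)$, and this bound is tight, i.e., there exist graphs $G$ with $\psi(G)=\gamma_M(G)+\gamma(G)$.
   Context: All graphs are finite, simple, undirected and connected, with at least $2$ vertices; $d(u,v)$ is the length of a shortest $u$-$v$ path. A set $S\subseteq V(G)$ is a resolving set if for every two distinct vertices $x,y$ there is $u\in S$ with $d(u,x)\neq d(u,y)$. $S$ is a dominating set if every vertex not in $S$ has a neighbor in $S$; $\gamma(G)$ is the minimum size of a dominating set. $S$ is a metric-locating-dominating set if it is both resolving and dominating; $\gamma_M(G)$ is its minimum size. Two vertices $u,v$ doubly resolve a pair $\{x,y\}$ if $d(u,x)-d(u,y)\neq d(v,x)-d(v,y)$; $S$ is a doubly resolving set if every pair of distinct vertices is doubly resolved by some two vertices of $S$; $\psi(G)$ is its minimum size. -}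

module Defs where

open import Data.Nat using (ℕ; zero; suc; _≤_; _+_)
open import Data.Integer as ℤ using (ℤ; +_)
open import Data.Fin using (Fin)
open import Data.Fin.Subset using (Subset; _∈_; _∉_; ∣_∣)
open import Data.Product using (Σ; ∃; ∃-syntax; _×_; _,_)
open import Relation.Binary.PropositionalEquality using (_≡_; _≢_)
open import Relation.Nullary using (¬_)
open import Level using (0ℓ)

record Graph : Set₁ where
  field
    n     : ℕ
    Adj   : Fin n → Fin n → Set
    sym   : ∀ {u v} → Adj u v → Adj v u
    irrefl : ∀ {u} → ¬ Adj u u
open Graph public

data Walk (G : Graph) : Fin (n G) → Fin (n G) → ℕ → Set where
  here : ∀ {u} → Walk G u u 0
  step : ∀ {u w v k} → Adj G u w → Walk G w v k → Walk G u v (suc k)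

Connected : Graph → Set
Connected G = ∀ u v → ∃[ k ] Walk G u v k

IsDist : (G : Graph) → Fin (n G) → Fin (n G) → ℕ → Set
IsDist G u v k = Walk G u v k × (∀ m → Walk G u v m → k ≤ m)

Admissible : Graph → Set
Admissible G = (2 ≤ n G) × Connected G

Resolving : (G : Graph) → Subset (n G) → Set
Resolving G S = ∀ x y → x ≢ y →
  ∃[ u ] (u ∈ S × (∀ k l → IsDist G u x k → IsDist G u y l → k ≢ l))

Dominating : (G : Graph) → Subset (n G) → Set
Dominating G S = ∀ x → x ∉ S → ∃[ u ] (u ∈ S × Adj G x u)

MetricLocatingDominating : (G : Graph) → Subset (n G) → Set
MetricLocatingDominating G S = Resolving G S × Dominating G S

DoublyResolve : (G : Graph) → (u v x y : Fin (n G)) → Set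
DoublyResolve G u v x y = ∀ a b c d →
  IsDist G u x a → IsDist G u y b → IsDist G v x c → IsDist G v y d →
  (+ a ℤ.- + b) ≢ (+ c ℤ.- + d)

DoublyResolving : (G : Graph) → Subset (n G) → Set
DoublyResolving G S = ∀ x y → x ≢ y →
  ∃[ u ] ∃[ v ] (u ∈ S × v ∈ S × DoublyResolve G u v x y)

IsMinSize : (m : ℕ) → (Subset m → Set) → ℕ → Set
IsMinSize m P k = (∃[ S ] (P S × ∣ S ∣ ≡ k)) × (∀ S → P S → k ≤ ∣ S ∣)

IsDomNumber IsMLDNumber IsDRNumber : Graph → ℕ → Set
IsDomNumber G = IsMinSize (n G) (Dominating G)
IsMLDNumber G = IsMinSize (n G) (MetricLocatingDominating G)
IsDRNumber  G = IsMinSize (n G) (DoublyResolving G)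

-- Let S be a metric-locating-dominating set and D a dominating set. Call y the shadow of x
-- when d(t,y) = d(t,x) + 1 for every t ∈ S; as S is resolving, x has at most one shadow.
-- Let T = S ∪ π(D), where π replaces a vertex of S by its shadow when it has one, so that
-- |T| ≤ |S| + |D|. Suppose x ≠ y are not doubly resolved by T, i.e. d(u,x) − d(u,y) is the
-- same for all u ∈ T. Both cannot lie in T. If x ∈ T and y ∉ T, the common difference is
-- −d(x,y), so any u ∈ T adjacent to y is x; taking S- and D-neighbours of y shows x ∈ S ∩ D
-- and that y is the shadow of x, whence y = π(x) ∈ T. If x, y ∉ T, an S-neighbour s of x is
-- also adjacent to y, so the difference vanishes on S, contradicting that S is resolving.
-- Equality holds for K₂, where ψ = 2 and γ_M = γ = 1.
module Submission where

open import Defs renaming (sym to Adj-sym)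
open import Data.Empty using (⊥-elim)
open import Data.Fin using (Fin; zero; suc)
open import Data.Fin.Properties using (all?; any?) renaming (_≟_ to _≟ᶠ_)
open import Data.Fin.Subset using (Subset; _∈_; _∉_; ∣_∣; inside; outside; _∪_; ⁅_⁆; ⊥; ⊤)
open import Data.Fin.Subset.Properties using (_∈?_; x∈⁅x⁆; p⊆p∪q; q⊆p∪q; ∣⁅x⁆∣≡1; ∣⊥∣≡0)
import Data.Integer as ℤ
import Data.Integer.Properties as ℤ
open import Data.Integer.Tactic.RingSolver using (solve-∀)
open import Data.Nat using (ℕ; zero; suc; _+_; _≤_; _<_; z≤n; s≤s; _≟_; _≤?_)
open import Data.Nat.Induction using (<-rec)
open import Data.Nat.Properties
open import Data.Product using (_×_; _,_; ∃-syntax; proj₁; proj₂)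
open import Data.Vec using ([]; _∷_; here; there)
open import Function using (_∘_)
open import Relation.Binary.PropositionalEquality
open import Relation.Nullary using (¬_; Dec; yes; no)
open import Relation.Nullary.Decidable using (decidable-stable; _×-dec_; _→-dec_; ¬?)

m+n≡1⇒m≡0 : ∀ m {n} → m + n ≡ 1 → n ≢ 0 → m ≡ 0
m+n≡1⇒m≡0 m {zero}  _  n≢0 = ⊥-elim (n≢0 refl)
m+n≡1⇒m≡0 m {suc n} eq _   = m+n≡0⇒m≡0 m (suc-injective (trans (sym (+-suc m n)) eq))

m+n≡2⇒n≡1 : ∀ {m n} → m + n ≡ 2 → m ≢ 0 → n ≢ 0 → n ≡ 1
m+n≡2⇒n≡1 {zero}              _  m≢0 _   = ⊥-elim (m≢0 refl)
m+n≡2⇒n≡1 {suc m} {zero}      _  _   n≢0 = ⊥-elim (n≢0 refl)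
m+n≡2⇒n≡1 {suc zero} {suc n}  eq _   _   = suc-injective eq
m+n≡2⇒n≡1 {suc (suc m)} {suc n} eq _ _
  with () ← trans (sym (+-suc m n)) (suc-injective (suc-injective eq))

m-n≡p-q⇒m+q≡p+n : ∀ m n p q → ℤ.+ m ℤ.- ℤ.+ n ≡ ℤ.+ p ℤ.- ℤ.+ q → m + q ≡ p + n
m-n≡p-q⇒m+q≡p+n m n p q eq = ℤ.+-injective (begin
  ℤ.+ m ℤ.+ ℤ.+ q                              ≡⟨ shift (ℤ.+ m) (ℤ.+ n) (ℤ.+ q) ⟩
  (ℤ.+ m ℤ.- ℤ.+ n) ℤ.+ (ℤ.+ n ℤ.+ ℤ.+ q)      ≡⟨ cong (ℤ._+ (ℤ.+ n ℤ.+ ℤ.+ q)) eq ⟩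
  (ℤ.+ p ℤ.- ℤ.+ q) ℤ.+ (ℤ.+ n ℤ.+ ℤ.+ q)      ≡⟨ unshift (ℤ.+ p) (ℤ.+ q) (ℤ.+ n) ⟩
  ℤ.+ p ℤ.+ ℤ.+ n                              ∎)
  where
  open ≡-Reasoning
  shift : ∀ a b c → a ℤ.+ c ≡ (a ℤ.- b) ℤ.+ (b ℤ.+ c)
  shift = solve-∀
  unshift : ∀ a c b → (a ℤ.- c) ℤ.+ (b ℤ.+ c) ≡ a ℤ.+ b
  unshift = solve-∀

∣p∪q∣≤∣p∣+∣q∣ : ∀ {k} (p q : Subset k) → ∣ p ∪ q ∣ ≤ ∣ p ∣ + ∣ q ∣
∣p∪q∣≤∣p∣+∣q∣ []            []            = z≤n
∣p∪q∣≤∣p∣+∣q∣ (inside ∷ p)  (inside ∷ q)  =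
  s≤s (≤-trans (∣p∪q∣≤∣p∣+∣q∣ p q) (+-monoʳ-≤ ∣ p ∣ (n≤1+n ∣ q ∣)))
∣p∪q∣≤∣p∣+∣q∣ (inside ∷ p)  (outside ∷ q) = s≤s (∣p∪q∣≤∣p∣+∣q∣ p q)
∣p∪q∣≤∣p∣+∣q∣ (outside ∷ p) (inside ∷ q)  =
  subst (suc ∣ p ∪ q ∣ ≤_) (sym (+-suc ∣ p ∣ ∣ q ∣)) (s≤s (∣p∪q∣≤∣p∣+∣q∣ p q))
∣p∪q∣≤∣p∣+∣q∣ (outside ∷ p) (outside ∷ q) = ∣p∪q∣≤∣p∣+∣q∣ p q

image : ∀ {k l} → (Fin k → Fin l) → Subset k → Subset l
image f []            = ⊥
image f (inside ∷ p)  = ⁅ f zero ⁆ ∪ image (f ∘ suc) p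
image f (outside ∷ p) = image (f ∘ suc) p

∈-image : ∀ {k l} (f : Fin k → Fin l) {p x} → x ∈ p → f x ∈ image f p
∈-image f {inside ∷ p}  here        = p⊆p∪q (image (f ∘ suc) p) (x∈⁅x⁆ (f zero))
∈-image f {inside ∷ p}  (there x∈p) = q⊆p∪q ⁅ f zero ⁆ _ (∈-image (f ∘ suc) x∈p)
∈-image f {outside ∷ p} (there x∈p) = ∈-image (f ∘ suc) x∈p

∣image∣≤∣p∣ : ∀ {k l} (f : Fin k → Fin l) p → ∣ image f p ∣ ≤ ∣ p ∣
∣image∣≤∣p∣ {l = l} f []   = ≤-reflexive (∣⊥∣≡0 l)
∣image∣≤∣p∣ f (outside ∷ p) = ∣image∣≤∣p∣ (f ∘ suc) p
∣image∣≤∣p∣ f (inside ∷ p)  = begin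
  ∣ ⁅ f zero ⁆ ∪ image (f ∘ suc) p ∣      ≤⟨ ∣p∪q∣≤∣p∣+∣q∣ ⁅ f zero ⁆ _ ⟩
  ∣ ⁅ f zero ⁆ ∣ + ∣ image (f ∘ suc) p ∣  ≡⟨ cong (_+ ∣ image (f ∘ suc) p ∣) (∣⁅x⁆∣≡1 (f zero)) ⟩
  suc ∣ image (f ∘ suc) p ∣               ≤⟨ s≤s (∣image∣≤∣p∣ (f ∘ suc) p) ⟩
  suc ∣ p ∣                               ∎
  where open ≤-Reasoning

x∈p⇒0<∣p∣ : ∀ {k} {p : Subset k} {x} → x ∈ p → 0 < ∣ p ∣
x∈p⇒0<∣p∣                     here        = s≤s z≤n
x∈p⇒0<∣p∣ {p = inside ∷ p}   (there _)   = s≤s z≤n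
x∈p⇒0<∣p∣ {p = outside ∷ p}  (there x∈p) = x∈p⇒0<∣p∣ x∈p

x≢y∈p⇒2≤∣p∣ : ∀ {k} {p : Subset k} {x y} → x ≢ y → x ∈ p → y ∈ p → 2 ≤ ∣ p ∣
x≢y∈p⇒2≤∣p∣ x≢y here        here        = ⊥-elim (x≢y refl)
x≢y∈p⇒2≤∣p∣ _   here        (there y∈p) = s≤s (x∈p⇒0<∣p∣ y∈p)
x≢y∈p⇒2≤∣p∣ _   (there x∈p) here        = s≤s (x∈p⇒0<∣p∣ x∈p)
x≢y∈p⇒2≤∣p∣ {p = s ∷ p} x≢y (there x∈p) (there y∈p) with s
... | inside  = m≤n⇒m≤1+n (x≢y∈p⇒2≤∣p∣ (x≢y ∘ cong suc) x∈p y∈p)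
... | outside = x≢y∈p⇒2≤∣p∣ (x≢y ∘ cong suc) x∈p y∈p

Resolving⇒0<∣S∣ : ∀ {G S} {x y : Fin (n G)} → x ≢ y → Resolving G S → 0 < ∣ S ∣
Resolving⇒0<∣S∣ x≢y S-res with _ , s∈S , _ ← S-res _ _ x≢y = x∈p⇒0<∣p∣ s∈S

Dominating⇒0<∣S∣ : ∀ {G S} → Fin (n G) → Dominating G S → 0 < ∣ S ∣
Dominating⇒0<∣S∣ {S = S} x S-dom with x ∈? S
... | yes x∈S = x∈p⇒0<∣p∣ x∈S
... | no  x∉S with _ , s∈S , _ ← S-dom x x∉S = x∈p⇒0<∣p∣ s∈S

¬¬-least : (P : ℕ → Set) {k : ℕ} → P k → ¬ ¬ (∃[ m ] (P m × (∀ l → P l → m ≤ l)))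
¬¬-least P {k} = <-rec (λ k → P k → ¬ ¬ Least) least-below k
  where
  Least = ∃[ m ] (P m × (∀ l → P l → m ≤ l))
  least-below : ∀ k → (∀ {l} → l < k → P l → ¬ ¬ Least) → P k → ¬ ¬ Least
  least-below k below pk ¬least = ¬least (k , pk , λ l pl → ≮⇒≥ (λ l<k → below l<k pl ¬least))

¬¬-∀-Fin : ∀ {k} {P : Fin k → Set} → (∀ i → ¬ ¬ P i) → ¬ ¬ (∀ i → P i)
¬¬-∀-Fin {zero}        _    ¬∀ = ¬∀ λ ()
¬¬-∀-Fin {suc k} {P} ¬¬P ¬∀ = ¬¬P zero λ p₀ →
  ¬¬-∀-Fin {P = P ∘ suc} (¬¬P ∘ suc) λ ps → ¬∀ λ { zero → p₀ ; (suc i) → ps i }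

-- Adj is not decidable, so shortest walks exist only up to double negation; this suffices
-- because the bound ψ ≤ γ_M + γ is a decidable statement.
¬¬-distances : ∀ {G} → Connected G → ¬ ¬ (∀ u v → ∃[ k ] IsDist G u v k)
¬¬-distances {G} conn = ¬¬-∀-Fin λ u → ¬¬-∀-Fin λ v →
  ¬¬-least (Walk G u v) (proj₂ (conn u v))

module Distances (G : Graph) (d : Fin (n G) → Fin (n G) → ℕ)
                 (d-isDist : ∀ u v → IsDist G u v (d u v)) where

  V : Set
  V = Fin (n G)

  IsDist⇒≡d : ∀ {u v k} → IsDist G u v k → k ≡ d u v
  IsDist⇒≡d {u} {v} (walk , shortest) with d-walk , d-shortest ← d-isDist u v =
    ≤-antisym (shortest _ d-walk) (d-shortest _ walk)

  d≡0⇒≡ : ∀ {u v} → d u v ≡ 0 → u ≡ v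
  d≡0⇒≡ {u} {v} eq with d-isDist u v
  ... | walk , _ with here ← subst (Walk G u v) eq walk = refl

  ≢⇒d≢0 : ∀ {u v} → u ≢ v → d u v ≢ 0
  ≢⇒d≢0 u≢v = u≢v ∘ d≡0⇒≡

  d-refl : ∀ u → d u u ≡ 0
  d-refl u with _ , shortest ← d-isDist u u = n≤0⇒n≡0 (shortest 0 here)

  Adj⇒d≡1 : ∀ {u v} → Adj G u v → d u v ≡ 1
  Adj⇒d≡1 {u} {v} uv with d-isDist u v
  ... | _ , shortest = ≤-antisym (shortest 1 (step uv here))
                         (n≢0⇒n>0 (≢⇒d≢0 λ { refl → irrefl G uv }))

  resolving : ∀ {S} → (∀ x y → x ≢ y → ∃[ s ] (s ∈ S × d s x ≢ d s y)) → Resolving G S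
  resolving res x y x≢y with s , s∈S , ≢ ← res x y x≢y =
    s , s∈S , λ k l sx sy k≡l → ≢ (trans (sym (IsDist⇒≡d sx)) (trans k≡l (IsDist⇒≡d sy)))

  Resolving⇒d≢ : ∀ {S} → Resolving G S → ∀ {x y} → x ≢ y → ∃[ s ] (s ∈ S × d s x ≢ d s y)
  Resolving⇒d≢ S-res {x} {y} x≢y with s , s∈S , ≢ ← S-res x y x≢y =
    s , s∈S , ≢ _ _ (d-isDist s x) (d-isDist s y)

  doublyResolve : ∀ {u v x y} → d u x + d v y ≢ d v x + d u y → DoublyResolve G u v x y
  doublyResolve {u} {v} {x} {y} ≢ a b c e ux uy vx vy eq
    rewrite IsDist⇒≡d ux | IsDist⇒≡d uy | IsDist⇒≡d vx | IsDist⇒≡d vy =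
    ≢ (m-n≡p-q⇒m+q≡p+n (d u x) (d u y) (d v x) (d v y) eq)

  ¬DoublyResolve-self : ∀ u x y → ¬ DoublyResolve G u u x y
  ¬DoublyResolve-self u x y dr =
    dr _ _ _ _ (d-isDist u x) (d-isDist u y) (d-isDist u x) (d-isDist u y) refl

  DoublyResolving⇒2≤∣S∣ : ∀ {S} {x y : V} → x ≢ y → DoublyResolving G S → 2 ≤ ∣ S ∣
  DoublyResolving⇒2≤∣S∣ {x = x} {y} x≢y S-dr with u , v , u∈S , v∈S , dr ← S-dr x y x≢y =
    x≢y∈p⇒2≤∣p∣ (λ { refl → ¬DoublyResolve-self u x y dr }) u∈S v∈S

  -- d(u,x) − d(u,y) = d(v,x) − d(v,y) for all u, v ∈ T, with the subtractions moved across.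
  SameDifference : Subset (n G) → V → V → Set
  SameDifference T x y = ∀ {u v} → u ∈ T → v ∈ T → d u x + d v y ≡ d v x + d u y

  SameDifference-sym : ∀ {T x y} → SameDifference T x y → SameDifference T y x
  SameDifference-sym {x = x} {y} same {u} {v} u∈T v∈T =
    trans (+-comm (d u y) (d v x)) (trans (same v∈T u∈T) (+-comm (d u x) (d v y)))

  doublyResolving : ∀ {T} → (∀ {x y} → x ≢ y → ¬ SameDifference T x y) → DoublyResolving G T
  doublyResolving {T} ¬same x y x≢y
    with any? (λ u → any? λ v → (u ∈? T) ×-dec ((v ∈? T) ×-dec ¬? (d u x + d v y ≟ d v x + d u y)))
  ... | yes (u , v , u∈T , v∈T , ≢) = u , v , u∈T , v∈T , doublyResolve ≢
  ... | no none = ⊥-elim (¬same x≢y same)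
    where
    same : SameDifference T x y
    same {u} {v} u∈T v∈T = decidable-stable (_ ≟ _) λ ≢ → none (u , v , u∈T , v∈T , ≢)

  SameDifference-∈⇒≡ : ∀ {T x y} → x ∈ T → y ∈ T → SameDifference T x y → x ≡ y
  SameDifference-∈⇒≡ {x = x} {y} x∈T y∈T same = d≡0⇒≡ (m+n≡0⇒n≡0 (d y x)
    (trans (sym (same x∈T y∈T)) (cong₂ _+_ (d-refl x) (d-refl y))))

  -- With x ∈ T the common difference is −d(x,y), so no vertex of T other than x is next to y.
  SameDifference-Adj⇒≡ : ∀ {T x y w} → x ≢ y → x ∈ T → w ∈ T → Adj G y w →
                         SameDifference T x y → w ≡ x
  SameDifference-Adj⇒≡ {x = x} {y} {w} x≢y x∈T w∈T yw same =
    d≡0⇒≡ (m+n≡1⇒m≡0 (d w x)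
      (trans (same w∈T x∈T) (cong₂ _+_ (d-refl x) (Adj⇒d≡1 (Adj-sym G yw))))
      (≢⇒d≢0 x≢y))

module ShadowConstruction (G : Graph) (d : Fin (n G) → Fin (n G) → ℕ)
                    (d-isDist : ∀ u v → IsDist G u v (d u v))
                    (S D : Subset (n G)) (S-res : Resolving G S)
                    (S-dom : Dominating G S) (D-dom : Dominating G D) where

  open Distances G d d-isDist

  Shadow : V → V → Set
  Shadow x y = ∀ t → t ∈ S → d t y ≡ suc (d t x)

  shadow? : ∀ x → Dec (∃[ y ] Shadow x y)
  shadow? x = any? λ y → all? λ t → (t ∈? S) →-dec (d t y ≟ suc (d t x))

  Shadow-unique : ∀ {x y y′} → Shadow x y → Shadow x y′ → y ≡ y′
  Shadow-unique {y = y} {y′} sh sh′ with y ≟ᶠ y′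
  ... | yes y≡y′ = y≡y′
  ... | no  y≢y′ with s , s∈S , ≢ ← Resolving⇒d≢ S-res y≢y′ =
    ⊥-elim (≢ (trans (sh s s∈S) (sym (sh′ s s∈S))))

  π : V → V
  π x with x ∈? S | shadow? x
  ... | yes _ | yes (y , _) = y
  ... | _     | _           = x

  π-∉ : ∀ {x} → x ∉ S → π x ≡ x
  π-∉ {x} x∉S with x ∈? S | shadow? x
  ... | yes x∈S | _     = ⊥-elim (x∉S x∈S)
  ... | no _    | _     = refl

  π-Shadow : ∀ {x y} → x ∈ S → Shadow x y → π x ≡ y
  π-Shadow {x} {y} x∈S sh with x ∈? S | shadow? x
  ... | yes _   | yes (y′ , sh′) = Shadow-unique sh′ sh
  ... | yes _   | no ¬sh         = ⊥-elim (¬sh (y , sh))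
  ... | no x∉S  | _              = ⊥-elim (x∉S x∈S)

  T : Subset (n G)
  T = S ∪ image π D

  S⊆T : ∀ {x} → x ∈ S → x ∈ T
  S⊆T = p⊆p∪q (image π D)

  πD⊆T : ∀ {x} → x ∈ D → π x ∈ T
  πD⊆T x∈D = q⊆p∪q S (image π D) (∈-image π x∈D)

  D⊆T : ∀ {x} → x ∈ D → x ∈ T
  D⊆T {x} x∈D with x ∈? S
  ... | yes x∈S = S⊆T x∈S
  ... | no  x∉S = subst (_∈ T) (π-∉ x∉S) (πD⊆T x∈D)

  ∣T∣≤∣S∣+∣D∣ : ∣ T ∣ ≤ ∣ S ∣ + ∣ D ∣
  ∣T∣≤∣S∣+∣D∣ = ≤-trans (∣p∪q∣≤∣p∣+∣q∣ S (image π D)) (+-monoʳ-≤ ∣ S ∣ (∣image∣≤∣p∣ π D))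

  ¬SameDifference-∈∉ : ∀ {x y} → x ≢ y → x ∈ T → y ∉ T → ¬ SameDifference T x y
  ¬SameDifference-∈∉ {x} {y} x≢y x∈T y∉T same
    with s , s∈S , ys ← S-dom y (y∉T ∘ S⊆T) | r , r∈D , yr ← D-dom y (y∉T ∘ D⊆T) =
    y∉T (subst (_∈ T) (π-Shadow x∈S shadow) (πD⊆T x∈D))
    where
    s≡x = SameDifference-Adj⇒≡ x≢y x∈T (S⊆T s∈S) ys same
    x∈S = subst (_∈ S) s≡x s∈S
    x∈D = subst (_∈ D) (SameDifference-Adj⇒≡ x≢y x∈T (D⊆T r∈D) yr same) r∈D
    dxy≡1 : d x y ≡ 1
    dxy≡1 = Adj⇒d≡1 (Adj-sym G (subst (Adj G y) s≡x ys))
    shadow : Shadow x y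
    shadow t t∈S = begin
      d t y             ≡⟨ cong (_+ d t y) (d-refl x) ⟨
      d x x + d t y     ≡⟨ same (S⊆T t∈S) x∈T ⟨
      d t x + d x y     ≡⟨ cong (d t x +_) dxy≡1 ⟩
      d t x + 1         ≡⟨ +-comm (d t x) 1 ⟩
      suc (d t x)       ∎
      where open ≡-Reasoning

  -- The S-neighbours s of x and s′ of y give d(s′,x) + d(s,y) = 2 with both terms positive.
  ¬SameDifference-∉∉ : ∀ {x y} → x ≢ y → x ∉ T → y ∉ T → ¬ SameDifference T x y
  ¬SameDifference-∉∉ {x} {y} x≢y x∉T y∉T same
    with s , s∈S , xs ← S-dom x (x∉T ∘ S⊆T) | s′ , s′∈S , ys′ ← S-dom y (y∉T ∘ S⊆T)
       | t , t∈S , dtx≢dty ← Resolving⇒d≢ S-res x≢y =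
    dtx≢dty (suc-injective (begin
      suc (d t x)       ≡⟨ +-comm 1 (d t x) ⟩
      d t x + 1         ≡⟨ cong (d t x +_) dsy≡1 ⟨
      d t x + d s y     ≡⟨ same (S⊆T s∈S) (S⊆T t∈S) ⟨
      d s x + d t y     ≡⟨ cong (_+ d t y) dsx≡1 ⟩
      suc (d t y)       ∎))
    where
    open ≡-Reasoning
    dsx≡1 = Adj⇒d≡1 (Adj-sym G xs)
    dsy≡1 : d s y ≡ 1
    dsy≡1 = m+n≡2⇒n≡1
      (trans (sym (same (S⊆T s∈S) (S⊆T s′∈S))) (cong₂ _+_ dsx≡1 (Adj⇒d≡1 (Adj-sym G ys′))))
      (≢⇒d≢0 λ { refl → x∉T (S⊆T s′∈S) })
      (≢⇒d≢0 λ { refl → y∉T (S⊆T s∈S) })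

  ¬SameDifference : ∀ {x y} → x ≢ y → ¬ SameDifference T x y
  ¬SameDifference {x} {y} x≢y same with x ∈? T | y ∈? T
  ... | yes x∈T | yes y∈T = x≢y (SameDifference-∈⇒≡ x∈T y∈T same)
  ... | yes x∈T | no  y∉T = ¬SameDifference-∈∉ x≢y x∈T y∉T same
  ... | no  x∉T | yes y∈T = ¬SameDifference-∈∉ (≢-sym x≢y) y∈T x∉T (SameDifference-sym same)
  ... | no  x∉T | no  y∉T = ¬SameDifference-∉∉ x≢y x∉T y∉T same

  T-doublyResolving : DoublyResolving G T
  T-doublyResolving = doublyResolving ¬SameDifference

ψ≤γM+γ : ∀ {G p m g} → Connected G →
         IsDRNumber G p → IsMLDNumber G m → IsDomNumber G g → p ≤ m + g
ψ≤γM+γ {G} conn (_ , ψ-least) ((S , (S-res , S-dom) , refl) , _) ((D , D-dom , refl) , _) =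
  decidable-stable (_ ≤? _) λ p≰ → ¬¬-distances conn λ dist →
    let open ShadowConstruction G (λ u v → proj₁ (dist u v)) (λ u v → proj₂ (dist u v))
                                S D S-res S-dom D-dom
    in p≰ (≤-trans (ψ-least T T-doublyResolving) ∣T∣≤∣S∣+∣D∣)

K₂ : Graph
K₂ = record { n = 2 ; Adj = _≢_ ; sym = ≢-sym ; irrefl = λ x≢x → x≢x refl }

d-K₂ : Fin 2 → Fin 2 → ℕ
d-K₂ zero       zero       = 0
d-K₂ zero       (suc zero) = 1
d-K₂ (suc zero) zero       = 1
d-K₂ (suc zero) (suc zero) = 0

d-K₂-isDist : ∀ u v → IsDist K₂ u v (d-K₂ u v)
d-K₂-isDist zero       zero       = here , λ _ _ → z≤n
d-K₂-isDist zero       (suc zero) = step (λ ()) here , λ { (suc _) _ → s≤s z≤n }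
d-K₂-isDist (suc zero) zero       = step (λ ()) here , λ { (suc _) _ → s≤s z≤n }
d-K₂-isDist (suc zero) (suc zero) = here , λ _ _ → z≤n

module K₂-Distances = Distances K₂ d-K₂ d-K₂-isDist

K₂-admissible : Admissible K₂
K₂-admissible = ≤-refl , λ u v → d-K₂ u v , proj₁ (d-K₂-isDist u v)

0≢1 : _≢_ {A = Fin 2} zero (suc zero)
0≢1 ()

⊤-doublyResolving : DoublyResolving K₂ ⊤
⊤-doublyResolving zero       zero       x≢y = ⊥-elim (x≢y refl)
⊤-doublyResolving zero       (suc zero) _   =
  zero , suc zero , here , there here , K₂-Distances.doublyResolve λ ()
⊤-doublyResolving (suc zero) zero       _   =
  zero , suc zero , here , there here , K₂-Distances.doublyResolve λ ()
⊤-doublyResolving (suc zero) (suc zero) x≢y = ⊥-elim (x≢y refl)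

⁅0⁆-resolving : Resolving K₂ ⁅ zero ⁆
⁅0⁆-resolving = K₂-Distances.resolving λ
  { zero zero x≢y → ⊥-elim (x≢y refl)
  ; zero (suc zero) _ → zero , here , λ ()
  ; (suc zero) zero _ → zero , here , λ ()
  ; (suc zero) (suc zero) x≢y → ⊥-elim (x≢y refl) }

⁅0⁆-dominating : Dominating K₂ ⁅ zero ⁆
⁅0⁆-dominating zero       x∉ = ⊥-elim (x∉ here)
⁅0⁆-dominating (suc zero) _  = zero , here , λ ()

K₂-ψ≡2 : IsDRNumber K₂ 2
K₂-ψ≡2 = (⊤ , ⊤-doublyResolving , refl) , λ _ → K₂-Distances.DoublyResolving⇒2≤∣S∣ 0≢1

K₂-γM≡1 : IsMLDNumber K₂ 1
K₂-γM≡1 = (⁅ zero ⁆ , (⁅0⁆-resolving , ⁅0⁆-dominating) , refl) ,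
          λ _ (S-res , _) → Resolving⇒0<∣S∣ 0≢1 S-res

K₂-γ≡1 : IsDomNumber K₂ 1
K₂-γ≡1 = (⁅ zero ⁆ , ⁅0⁆-dominating , refl) , λ _ → Dominating⇒0<∣S∣ {K₂} zero

theorem5 : ((G : Graph) → Admissible G → (p m g : ℕ) →
             IsDRNumber G p → IsMLDNumber G m → IsDomNumber G g → p ≤ m + g)
           × (∃[ G ] (Admissible G × (∃[ p ] ∃[ m ] ∃[ g ]
               (IsDRNumber G p × IsMLDNumber G m × IsDomNumber G g × p ≡ m + g))))
theorem5 =
  (λ G (_ , conn) p m g → ψ≤γM+γ conn) ,
  (K₂ , K₂-admissible , 2 , 1 , 1 , K₂-ψ≡2 , K₂-γM≡1 , K₂-γ≡1 , refl)
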